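{- Let $T_8=\{12,\overline{1}\,\overline{2},2\overline{1}\}$ and let $\tau\in\{21,\overline{2}1\}$. Then $b_n(T_8\cup\{\tau\})=2n$ for every $n\ge 1$.
   Context: A signed permutation of length $n$ is a word $\alpha=\alpha_1\cdots\alpha_n$ in which each of the symbols $1,\dots,n$ appears exactly once, each occurrence possibly barred (written $\overline{i}$). The set of all of them is $B_n$. For a symbol $x$, $|x|$ denotes the underlying number with any bar removed. For $\tau=\tau_1\cdots\tau_k\in B_k$ and $\alpha\in B_n$, $\alpha$ contains $\tau$ if there are indices $1\le i_1<\cdots<i_k\le n$ such that (1) $|\alpha_{i_p}|>|\alpha_{i_q}|$ if and only if $|\tau_p|>|\tau_q|$ for all $p,q$, and (2) $\alpha_{i_j}$ is barred if and only if $\tau_j$ is barred for every $j$. Otherwise $\alpha$ avoids $\tau$. $B_n(T)$ is the set of $\alpha\in B_n$ avoiding every pattern in $T$, and $b_n(T)=|B_n(T)|$. -}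

module Defs where

open import Data.Nat using (ℕ; _*_)
open import Data.Fin using (Fin; _<_)
open import Data.Bool using (Bool; true; false)
open import Data.Product using (_×_; proj₁; proj₂; Σ; _,_)
open import Data.Unit using (⊤)
open import Data.Fin using (zero; suc)
open import Data.Vec using (Vec; lookup; []; _∷_)
open import Data.List using (List; length; _∷_; [])
open import Data.List.Membership.Propositional using (_∈_)
open import Data.List.Relation.Unary.Unique.Propositional using (Unique)
open import Relation.Binary.PropositionalEquality using (_≡_)
open import Relation.Nullary using (¬_)
open import Function.Definitions using (Injective)
open import Function.Bundles using (_⇔_)

-- A symbol of a word of length n: its underlying value |x| (in Fin n, i.e. value
-- 0..n-1 standing for 1..n) together with a flag saying whether it is barred.
Symbol : ℕ → Set
Symbol n = Fin n × Bool

∣_∣ : ∀ {n} → Symbol n → Fin n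
∣ x ∣ = proj₁ x

barred : ∀ {n} → Symbol n → Bool
barred x = proj₂ x

Word : ℕ → Set
Word n = Vec (Symbol n) n

-- α is a signed permutation: every value 1..n occurs exactly once
-- (n values in n positions, injective ⇔ each appears exactly once).
IsSignedPerm : ∀ {n} → Word n → Set
IsSignedPerm {n} α = Injective _≡_ _≡_ (λ (i : Fin n) → ∣ lookup α i ∣)

Contains : ∀ {n k} → Word n → Word k → Set
Contains {n} {k} α τ =
  Σ (Fin k → Fin n) λ ι →
    (∀ p q → p < q → ι p < ι q) ×
    (∀ p q → (∣ lookup α (ι p) ∣ < ∣ lookup α (ι q) ∣ → ∣ lookup τ p ∣ < ∣ lookup τ q ∣)
           × (∣ lookup τ p ∣ < ∣ lookup τ q ∣ → ∣ lookup α (ι p) ∣ < ∣ lookup α (ι q) ∣)) ×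
    (∀ j → barred (lookup α (ι j)) ≡ barred (lookup τ j))

Avoids : ∀ {n k} → Word n → Word k → Set
Avoids α τ = ¬ Contains α τ

Pattern : Set
Pattern = Σ ℕ Word

AvoidsAll : ∀ {n} → Word n → List Pattern → Set
AvoidsAll α [] = ⊤
AvoidsAll α ((k , τ) ∷ T) = Avoids α τ × AvoidsAll α T

InB : ∀ n → List Pattern → Word n → Set
InB n T α = IsSignedPerm α × AvoidsAll α T

HasCount : ∀ n → List Pattern → ℕ → Set
HasCount n T m =
  Σ (List (Word n)) λ L → Unique L × (∀ α → (α ∈ L) ⇔ InB n T α) × (length L ≡ m)

-- Concrete patterns (value zero = 1, suc zero = 2; true = barred).
one two : Fin 2
one = zero
two = suc zero

pat : Symbol 2 → Symbol 2 → Pattern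
pat x y = 2 , (x ∷ y ∷ [])

p12 : Pattern
p12 = pat (one , false) (two , false)

p1b2b : Pattern
p1b2b = pat (one , true) (two , true)

p21b : Pattern
p21b = pat (two , false) (one , true)

p21 : Pattern
p21 = pat (two , false) (one , false)

p2b1 : Pattern
p2b1 = pat (two , true) (one , false)

T8 : List Pattern
T8 = p12 ∷ p1b2b ∷ p21b ∷ []

-- Every pattern involved has length two, so avoiding them is a condition on each pair of
-- letters that depends only on their bars and on which of the two is larger.
--
-- For T₈ ∪ {2̄1}, letters with equal bars descend and letters with different bars ascend.
-- Hence the letter of value 1 ends the first of two decreasing runs with opposite bars,
-- and the first run carries the smallest values: such a word is fixed by the bar and the
-- length of its first run, which gives 2n words.
--
-- For T₈ ∪ {21}, barred letters descend, at most one letter is unbarred, and it lies below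
-- every later letter. Either all letters are barred (one word), or the last letter is the
-- unbarred one and its value is free (n words), or an earlier letter is unbarred; it then
-- lies below its right neighbour, which lies below every letter before it, so its value
-- is 1 (n − 1 words).
--
-- Uniqueness within each family holds because a signed permutation is determined by its
-- bars together with the relative order of its letters.
module Submission where

open import Defs
open import Data.Bool as Bool using (Bool; true; false; not)
open import Data.Empty using (⊥; ⊥-elim)
open import Data.Fin using (Fin; zero; suc; toℕ; fromℕ; fromℕ<; inject₁; lower₁; punchIn; punchOut; opposite; _<_; _≟_; _≤?_)
open import Data.Fin.Induction using (<-wellFounded)
open import Data.Fin.Properties using (<-cmp; <⇒≢; ≤∧≢⇒<; any?; toℕ<n; toℕ-fromℕ; toℕ-fromℕ<; fromℕ<-toℕ; toℕ-injective; injective⇒≤; opposite-prop; punchIn-injective; punchIn-mono-≤; punchInᵢ≢i; punchOut-injective; punchOut-mono-≤; inject₁-injective; inject₁-lower₁; fromℕ≢inject₁; ≤̄⇒inject₁<)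
open import Data.List as List using (List; _∷_; _++_; length)
open import Data.List.Membership.Propositional using (_∈_)
open import Data.List.Membership.Propositional.Properties using (∈-tabulate⁺; ∈-tabulate⁻; ∈-++⁺ˡ; ∈-++⁺ʳ; ∈-++⁻)
open import Data.List.Properties using (length-++; length-tabulate)
open import Data.List.Relation.Unary.Unique.Propositional using (Unique)
import Data.List.Relation.Unary.Unique.Propositional.Properties as Unique
open import Data.Nat as ℕ using (ℕ; zero; suc; _∸_; _+_; _*_; z≤n; s≤s; z<s; s≤s⁻¹)
open import Data.Nat.Properties using (<-irrefl; <-asym; <-trans; ≤-refl; <⇒≤; ≤-trans; ≤-<-trans; <-≤-trans; ≰⇒>; n≮0; 1+n≰n; m∸n≤m; ∸-monoˡ-<; ∸-monoʳ-<; m+n≤o⇒m≤o∸n; m+[n∸m]≡n; +-suc; +-identityʳ)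
open import Data.Product using (_×_; _,_; proj₁; proj₂; ∃; ∃₂)
open import Data.Sum as Sum using (_⊎_; inj₁; inj₂; [_,_])
open import Data.Unit using (⊤; tt)
open import Data.Vec using (Vec; lookup; tabulate)
open import Data.Vec.Properties using (lookup∘tabulate; tabulate∘lookup; tabulate-cong)
open import Function.Base using (_∘_)
open import Function.Bundles using (_⇔_; mk⇔; Equivalence)
open import Function.Definitions using (Injective)
open import Induction.WellFounded using (module All)
open import Relation.Binary using (tri<; tri≈; tri>)
import Relation.Binary.Construct.On as On
open import Relation.Binary.PropositionalEquality using (_≡_; _≢_; _≗_; refl; sym; trans; cong; cong₂; subst; subst₂; module ≡-Reasoning)
open import Relation.Nullary using (yes; no; contradiction)

open Equivalence using (to; from)

injective⇒surjective : ∀ {N} {f : Fin N → Fin N} → Injective _≡_ _≡_ f → ∀ y → ∃ λ i → f i ≡ y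
injective⇒surjective {suc N} {f} f-inj y with any? (λ i → f i ≟ y)
... | yes hit = hit
... | no miss = contradiction (injective⇒≤ squeeze-injective) 1+n≰n
  where
  y≢f : ∀ i → y ≢ f i
  y≢f i y≡fi = miss (i , sym y≡fi)
  squeeze : Fin (suc N) → Fin N
  squeeze i = punchOut (y≢f i)
  squeeze-injective : Injective _≡_ _≡_ squeeze
  squeeze-injective {i} {j} eq = f-inj (punchOut-injective (y≢f i) (y≢f j) eq)

distinct⇒injective : ∀ {N} {f : Fin N → Fin N} → (∀ {k l} → k < l → f k ≢ f l) → Injective _≡_ _≡_ f
distinct⇒injective distinct {i} {j} eq with <-cmp i j
... | tri< i<j _ _ = contradiction eq (distinct i<j)
... | tri≈ _ i≡j _ = i≡j
... | tri> _ _ j<i = contradiction (sym eq) (distinct j<i)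

least-value≡zero : ∀ {n} {f : Fin (suc n) → Fin (suc n)} {j} → Injective _≡_ _≡_ f →
  (∀ {k} → j ≢ k → f j < f k) → f j ≡ zero
least-value≡zero {f = f} {j} f-inj below with injective⇒surjective f-inj zero
... | i , fi≡0 with j ≟ i
...   | yes refl = fi≡0
...   | no j≢i = ⊥-elim (n≮0 (subst (f j <_) fi≡0 (below j≢i)))

-- By induction on the value f i: if f i ≢ g i, the preimage of the smaller of f i and g i
-- under the other map contradicts the induction hypothesis or the order agreement.
module _ {N} {f g : Fin N → Fin N} (f-inj : Injective _≡_ _≡_ f) (g-inj : Injective _≡_ _≡_ g)
  (agree : ∀ {i j} → f i ≢ g i → f j ≢ g j → f i < f j → g i < g j) where

  private
    AgreeBelow : Fin N → Set
    AgreeBelow i = ∀ {i′} → f i′ < f i → f i′ ≡ g i′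

    g<f⇒agree : ∀ {i} → AgreeBelow i → g i < f i → f i ≡ g i
    g<f⇒agree {i} below gi<fi with injective⇒surjective f-inj (g i)
    ... | i′ , fi′≡gi = subst (λ m → f m ≡ g i) i′≡i fi′≡gi
      where
      i′≡i : i′ ≡ i
      i′≡i = g-inj (trans (sym (below (subst (_< f i) (sym fi′≡gi) gi<fi))) fi′≡gi)

    disagree-preimage : ∀ {i j} → f i ≢ g i → g j ≡ f i → f j ≢ g j
    disagree-preimage {i} fi≢gi gj≡fi fj≡gj =
      fi≢gi (sym (subst (λ m → g m ≡ f i) (f-inj (trans fj≡gj gj≡fi)) gj≡fi))

    f<g⇒⊥ : ∀ {i} → AgreeBelow i → f i < g i → ⊥
    f<g⇒⊥ {i} below fi<gi with injective⇒surjective g-inj (f i)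
    ... | j , gj≡fi with <-cmp (f j) (f i) | disagree-preimage (<⇒≢ fi<gi) gj≡fi
    ...   | tri< fj<fi _ _ | fj≢gj = fj≢gj (below fj<fi)
    ...   | tri≈ _ fj≡fi _ | fj≢gj = fj≢gj (trans fj≡fi (sym gj≡fi))
    ...   | tri> _ _ fi<fj | fj≢gj =
      <-asym fi<gi (subst (g i <_) gj≡fi (agree (<⇒≢ fi<gi) fj≢gj fi<fj))

  ≗-from-order : f ≗ g
  ≗-from-order = All.wfRec (On.wellFounded f <-wellFounded) _ (λ i → f i ≡ g i) step
    where
    step : ∀ i → AgreeBelow i → f i ≡ g i
    step i below with <-cmp (g i) (f i)
    ... | tri≈ _ gi≡fi _ = sym gi≡fi
    ... | tri< gi<fi _ _ = g<f⇒agree below gi<fi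
    ... | tri> _ _ fi<gi = ⊥-elim (f<g⇒⊥ below fi<gi)

SameDirection : ∀ {N} → Fin N → Fin N → Fin N → Fin N → Set
SameDirection v w v′ w′ = (v < w → v′ < w′) × (w < v → w′ < v′)

ascents : ∀ {N} {v w v′ w′ : Fin N} → v < w → v′ < w′ → SameDirection v w v′ w′
ascents v<w v′<w′ = (λ _ → v′<w′) , (λ w<v → ⊥-elim (<-asym v<w w<v))

descents : ∀ {N} {v w v′ w′ : Fin N} → w < v → w′ < v′ → SameDirection v w v′ w′
descents w<v w′<v′ = (λ v<w → ⊥-elim (<-asym v<w w<v)) , (λ _ → w′<v′)

order-from-pairs : ∀ {N} {f g : Fin N → Fin N} (P : Fin N → Set) →
  (∀ {k l} → k < l → P k → P l → SameDirection (f k) (f l) (g k) (g l)) →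
  ∀ {i j} → P i → P j → f i < f j → g i < g j
order-from-pairs P pairs {i} {j} pi pj fi<fj with <-cmp i j
... | tri< i<j _ _ = proj₁ (pairs i<j pi pj) fi<fj
... | tri≈ _ refl _ = ⊥-elim (<-irrefl refl fi<fj)
... | tri> _ _ j<i = proj₂ (pairs j<i pj pi) fi<fj

Enumerates : ∀ {A : Set} → List A → (A → Set) → Set
Enumerates xs P = Unique xs × (∀ x → x ∈ xs ⇔ P x)

Image : ∀ {A : Set} {m} → (Fin m → A) → A → Set
Image f x = ∃ λ i → f i ≡ x

tabulate-enumerates : ∀ {A : Set} {m} {f : Fin m → A} → Injective _≡_ _≡_ f →
  Enumerates (List.tabulate f) (Image f)
tabulate-enumerates {f = f} f-inj = Unique.tabulate⁺ f-inj , λ x → mk⇔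
  (λ x∈ → let i , x≡fi = ∈-tabulate⁻ x∈ in i , sym x≡fi)
  (λ (i , fi≡x) → subst (_∈ List.tabulate f) fi≡x (∈-tabulate⁺ i))

++-enumerates : ∀ {A : Set} {xs ys : List A} {P Q : A → Set} →
  Enumerates xs P → Enumerates ys Q → (∀ {x} → P x → Q x → ⊥) →
  Enumerates (xs ++ ys) (λ x → P x ⊎ Q x)
++-enumerates {xs = xs} (xs-unique , ∈xs⇔) (ys-unique , ∈ys⇔) disjoint =
  Unique.++⁺ xs-unique ys-unique (λ (∈xs , ∈ys) → disjoint (to (∈xs⇔ _) ∈xs) (to (∈ys⇔ _) ∈ys)) ,
  λ x → mk⇔ (Sum.map (to (∈xs⇔ x)) (to (∈ys⇔ x)) ∘ ∈-++⁻ xs)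
            [ ∈-++⁺ˡ ∘ from (∈xs⇔ x) , ∈-++⁺ʳ xs ∘ from (∈ys⇔ x) ]

enumerates-⇔ : ∀ {A : Set} {xs : List A} {P Q : A → Set} →
  (∀ x → P x ⇔ Q x) → Enumerates xs P → Enumerates xs Q
enumerates-⇔ P⇔Q (unique , ∈⇔) =
  unique , λ x → mk⇔ (to (P⇔Q x) ∘ to (∈⇔ x)) (from (∈⇔ x) ∘ from (P⇔Q x))

length-tabulate-++ : ∀ {A : Set} {m k} (f : Fin m → A) (g : Fin k → A) →
  length (List.tabulate f ++ List.tabulate g) ≡ m + k
length-tabulate-++ f g =
  trans (length-++ (List.tabulate f)) (cong₂ _+_ (length-tabulate f) (length-tabulate g))

Arrangement : ℕ → Set
Arrangement N = Fin N → Symbol N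

ValuesInjective : ∀ {N} → Arrangement N → Set
ValuesInjective a = Injective _≡_ _≡_ (∣_∣ ∘ a)

≗-from-bars-and-order : ∀ {N} {a e : Arrangement N} → ValuesInjective a → ValuesInjective e →
  (∀ i → barred (a i) ≡ barred (e i)) →
  (∀ {i j} → ∣ a i ∣ ≢ ∣ e i ∣ → ∣ a j ∣ ≢ ∣ e j ∣ → ∣ a i ∣ < ∣ a j ∣ → ∣ e i ∣ < ∣ e j ∣) →
  a ≗ e
≗-from-bars-and-order a-inj e-inj same-bars agree i =
  cong₂ _,_ (≗-from-order a-inj e-inj agree i) (same-bars i)

tabulate-≗-lookup : ∀ {A : Set} {n} {xs : Vec A n} {f : Fin n → A} → lookup xs ≗ f → tabulate f ≡ xs
tabulate-≗-lookup {xs = xs} xs≗f = trans (sym (tabulate-cong xs≗f)) (tabulate∘lookup xs)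

tabulate-injective : ∀ {A : Set} {n} {f g : Fin n → A} → tabulate f ≡ tabulate g → f ≗ g
tabulate-injective {f = f} {g} eq i =
  trans (sym (lookup∘tabulate f i)) (trans (cong (λ xs → lookup xs i) eq) (lookup∘tabulate g i))

-- Two-letter patterns as rules on pairs of letters

Rule : ℕ → Set₁
Rule N = Bool → Bool → Fin N → Fin N → Set

Respects : ∀ {N} → Rule N → Arrangement N → Set
Respects Q a = ∀ {k l} → k < l → Q (barred (a k)) (barred (a l)) ∣ a k ∣ ∣ a l ∣

-- Two barred letters must descend (1̄2̄), an unbarred letter must lie below a later
-- barred one (21̄), and two unbarred letters cannot coexist (12 and 21).
rule21 : ∀ {N} → Rule N
rule21 true  true  v w = w < v
rule21 true  false v w = ⊤
rule21 false true  v w = v < w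
rule21 false false v w = ⊥

-- Letters with equal bars descend (12, 1̄2̄), letters with different bars ascend (21̄, 2̄1).
rule2b1 : ∀ {N} → Rule N
rule2b1 true  true  v w = w < v
rule2b1 true  false v w = v < w
rule2b1 false true  v w = v < w
rule2b1 false false v w = w < v

pair⇒contains : ∀ {N} {α : Word N} {x y : Symbol 2} {k l} → k < l →
  barred (lookup α k) ≡ barred x → barred (lookup α l) ≡ barred y →
  (∣ lookup α k ∣ < ∣ lookup α l ∣ → ∣ x ∣ < ∣ y ∣) → (∣ x ∣ < ∣ y ∣ → ∣ lookup α k ∣ < ∣ lookup α l ∣) →
  (∣ lookup α l ∣ < ∣ lookup α k ∣ → ∣ y ∣ < ∣ x ∣) → (∣ y ∣ < ∣ x ∣ → ∣ lookup α l ∣ < ∣ lookup α k ∣) →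
  Contains α (proj₂ (pat x y))
pair⇒contains {N} {α} {x} {y} {k} {l} k<l bk bl up⇒ ⇒up down⇒ ⇒down = at , increasing , order , bars
  where
  τ : Word 2
  τ = proj₂ (pat x y)
  at : Fin 2 → Fin N
  at zero = k
  at (suc zero) = l
  increasing : ∀ p q → p < q → at p < at q
  increasing zero (suc zero) _ = k<l
  increasing (suc zero) (suc zero) 1<1 = ⊥-elim (<-irrefl refl 1<1)
  irrefl⇔ : ∀ {M M′} {u : Fin M} {v : Fin M′} → (u < u → v < v) × (v < v → u < u)
  irrefl⇔ = (λ u<u → ⊥-elim (<-irrefl refl u<u)) , (λ v<v → ⊥-elim (<-irrefl refl v<v))
  order : ∀ p q → (∣ lookup α (at p) ∣ < ∣ lookup α (at q) ∣ → ∣ lookup τ p ∣ < ∣ lookup τ q ∣)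
                × (∣ lookup τ p ∣ < ∣ lookup τ q ∣ → ∣ lookup α (at p) ∣ < ∣ lookup α (at q) ∣)
  order zero zero = irrefl⇔
  order zero (suc zero) = up⇒ , ⇒up
  order (suc zero) zero = down⇒ , ⇒down
  order (suc zero) (suc zero) = irrefl⇔
  bars : ∀ p → barred (lookup α (at p)) ≡ barred (lookup τ p)
  bars zero = bk
  bars (suc zero) = bl

ascent⇒contains : ∀ {N} (α : Word N) {k l s t} → k < l →
  barred (lookup α k) ≡ s → barred (lookup α l) ≡ t → ∣ lookup α k ∣ < ∣ lookup α l ∣ →
  Contains α (proj₂ (pat (one , s) (two , t)))
ascent⇒contains α {s = s} {t} k<l bk bl up =
  pair⇒contains {α = α} {one , s} {two , t} k<l bk bl
    (λ _ → z<s) (λ _ → up) (λ down → ⊥-elim (<-asym up down)) (λ ())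

descent⇒contains : ∀ {N} (α : Word N) {k l s t} → k < l →
  barred (lookup α k) ≡ s → barred (lookup α l) ≡ t → ∣ lookup α l ∣ < ∣ lookup α k ∣ →
  Contains α (proj₂ (pat (two , s) (one , t)))
descent⇒contains α {s = s} {t} k<l bk bl down =
  pair⇒contains {α = α} {two , s} {one , t} k<l bk bl
    (λ up → ⊥-elim (<-asym up down)) (λ ()) (λ _ → z<s) (λ _ → down)

Excludes : ∀ {N} → Rule N → Symbol 2 → Symbol 2 → Set
Excludes Q x y = ∀ {v w} → Q (barred x) (barred y) v w →
  (∣ x ∣ < ∣ y ∣ → v < w) → (∣ y ∣ < ∣ x ∣ → w < v) → ⊥

respects⇒avoids : ∀ {N} (Q : Rule N) (α : Word N) {x y} →
  Respects Q (lookup α) → Excludes Q x y → Avoids α (proj₂ (pat x y))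
respects⇒avoids Q α r excluded (at , increasing , order , bars)
  with r (increasing zero (suc zero) z<s)
... | q rewrite bars zero | bars (suc zero) =
  excluded q (proj₂ (order zero (suc zero))) (proj₂ (order (suc zero) zero))

signedPerm-distinct : ∀ {N} (α : Word N) {k l} → IsSignedPerm α → k < l → ∣ lookup α k ∣ ≢ ∣ lookup α l ∣
signedPerm-distinct α perm k<l eq = <⇒≢ k<l (perm eq)

avoids⇔respects21 : ∀ {N} (α : Word N) → IsSignedPerm α →
  AvoidsAll α (p21 ∷ T8) ⇔ Respects rule21 (lookup α)
avoids⇔respects21 α perm = mk⇔ avoids⇒respects respects⇒avoids21
  where
  avoids⇒respects : AvoidsAll α (p21 ∷ T8) → Respects rule21 (lookup α)
  avoids⇒respects (no21 , no12 , no1̄2̄ , no21̄ , _) {k} {l} k<l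
    with barred (lookup α k) in bk | barred (lookup α l) in bl | <-cmp ∣ lookup α k ∣ ∣ lookup α l ∣
  ... | _     | _     | tri≈ _ eq _   = ⊥-elim (signedPerm-distinct α perm k<l eq)
  ... | true  | true  | tri< up _ _   = ⊥-elim (no1̄2̄ (ascent⇒contains α k<l bk bl up))
  ... | true  | true  | tri> _ _ down = down
  ... | true  | false | _             = tt
  ... | false | true  | tri< up _ _   = up
  ... | false | true  | tri> _ _ down = ⊥-elim (no21̄ (descent⇒contains α k<l bk bl down))
  ... | false | false | tri< up _ _   = ⊥-elim (no12 (ascent⇒contains α k<l bk bl up))
  ... | false | false | tri> _ _ down = ⊥-elim (no21 (descent⇒contains α k<l bk bl down))
  respects⇒avoids21 : Respects rule21 (lookup α) → AvoidsAll α (p21 ∷ T8)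
  respects⇒avoids21 r =
      respects⇒avoids rule21 α r (λ ())
    , respects⇒avoids rule21 α r (λ ())
    , respects⇒avoids rule21 α r (λ down up _ → <-asym down (up z<s))
    , respects⇒avoids rule21 α r (λ up _ down → <-asym up (down z<s))
    , tt

avoids⇔respects2b1 : ∀ {N} (α : Word N) → IsSignedPerm α →
  AvoidsAll α (p2b1 ∷ T8) ⇔ Respects rule2b1 (lookup α)
avoids⇔respects2b1 α perm = mk⇔ avoids⇒respects respects⇒avoids2b1
  where
  avoids⇒respects : AvoidsAll α (p2b1 ∷ T8) → Respects rule2b1 (lookup α)
  avoids⇒respects (no2̄1 , no12 , no1̄2̄ , no21̄ , _) {k} {l} k<l
    with barred (lookup α k) in bk | barred (lookup α l) in bl | <-cmp ∣ lookup α k ∣ ∣ lookup α l ∣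
  ... | _     | _     | tri≈ _ eq _   = ⊥-elim (signedPerm-distinct α perm k<l eq)
  ... | true  | true  | tri< up _ _   = ⊥-elim (no1̄2̄ (ascent⇒contains α k<l bk bl up))
  ... | true  | true  | tri> _ _ down = down
  ... | true  | false | tri< up _ _   = up
  ... | true  | false | tri> _ _ down = ⊥-elim (no2̄1 (descent⇒contains α k<l bk bl down))
  ... | false | true  | tri< up _ _   = up
  ... | false | true  | tri> _ _ down = ⊥-elim (no21̄ (descent⇒contains α k<l bk bl down))
  ... | false | false | tri< up _ _   = ⊥-elim (no12 (ascent⇒contains α k<l bk bl up))
  ... | false | false | tri> _ _ down = down
  respects⇒avoids2b1 : Respects rule2b1 (lookup α) → AvoidsAll α (p2b1 ∷ T8)
  respects⇒avoids2b1 r =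
      respects⇒avoids rule2b1 α r (λ up _ down → <-asym up (down z<s))
    , respects⇒avoids rule2b1 α r (λ down up _ → <-asym down (up z<s))
    , respects⇒avoids rule2b1 α r (λ down up _ → <-asym down (up z<s))
    , respects⇒avoids rule2b1 α r (λ up _ down → <-asym up (down z<s))
    , tt

tabulate-inB : ∀ {N T} {Q : Rule N} {e : Arrangement N} →
  (∀ (α : Word N) → IsSignedPerm α → AvoidsAll α T ⇔ Respects Q (lookup α)) →
  ValuesInjective e → Respects Q e → InB N T (tabulate e)
tabulate-inB {Q = Q} {e} avoids⇔respects e-inj r =
  perm , from (avoids⇔respects (tabulate e) perm) respects
  where
  perm : IsSignedPerm (tabulate e)
  perm {i} {j} eq =
    e-inj (trans (cong proj₁ (sym (lookup∘tabulate e i))) (trans eq (cong proj₁ (lookup∘tabulate e j))))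
  respects : Respects Q (lookup (tabulate e))
  respects {k} {l} k<l = subst₂ (λ x y → Q (barred x) (barred y) ∣ x ∣ ∣ y ∣)
    (sym (lookup∘tabulate e k)) (sym (lookup∘tabulate e l)) (r k<l)

-- T₈ ∪ {2̄1}: two decreasing runs

rule2b1-same : ∀ {N} b {v w : Fin N} → w < v → rule2b1 b b v w
rule2b1-same true  w<v = w<v
rule2b1-same false w<v = w<v

rule2b1-flip : ∀ {N} b {v w : Fin N} → v < w → rule2b1 b (not b) v w
rule2b1-flip true  v<w = v<w
rule2b1-flip false v<w = v<w

rule2b1-distinct : ∀ {N} {b c} {v w : Fin N} → rule2b1 b c v w → v ≢ w
rule2b1-distinct {b = true}  {true}  w<v refl = <-irrefl refl w<v
rule2b1-distinct {b = true}  {false} v<w refl = <-irrefl refl v<w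
rule2b1-distinct {b = false} {true}  v<w refl = <-irrefl refl v<w
rule2b1-distinct {b = false} {false} w<v refl = <-irrefl refl w<v

rule2b1-same-direction : ∀ {N} {b c b′ c′} {v w v′ w′ : Fin N} → b ≡ b′ → c ≡ c′ →
  rule2b1 b c v w → rule2b1 b′ c′ v′ w′ → SameDirection v w v′ w′
rule2b1-same-direction {b = true}  {true}  refl refl = descents
rule2b1-same-direction {b = true}  {false} refl refl = ascents
rule2b1-same-direction {b = false} {true}  refl refl = ascents
rule2b1-same-direction {b = false} {false} refl refl = descents

rule2b1-into-zero : ∀ {n} {b c} {v w : Fin (suc n)} → w ≡ zero → rule2b1 b c v w → b ≡ c
rule2b1-into-zero {b = true}  {true}  refl _  = refl
rule2b1-into-zero {b = true}  {false} refl ()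
rule2b1-into-zero {b = false} {true}  refl ()
rule2b1-into-zero {b = false} {false} refl _  = refl

rule2b1-from-zero : ∀ {n} {b c} {v w : Fin (suc n)} → v ≡ zero → rule2b1 b c v w → c ≡ not b
rule2b1-from-zero {b = true}  {true}  refl ()
rule2b1-from-zero {b = true}  {false} refl _  = refl
rule2b1-from-zero {b = false} {true}  refl _  = refl
rule2b1-from-zero {b = false} {false} refl ()

fromℕ<-mono-< : ∀ {N a b} .{p : a ℕ.< N} .{q : b ℕ.< N} → a ℕ.< b → fromℕ< p < fromℕ< q
fromℕ<-mono-< {p = p} {q} a<b = subst₂ ℕ._<_ (sym (toℕ-fromℕ< p)) (sym (toℕ-fromℕ< q)) a<b

-- Positions 0, …, m carry m, …, 0 and are barred iff b;
-- positions m + 1, …, n carry n, …, m + 1 and are barred iff not b.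
twoRuns : ∀ {n} → Bool → Fin (suc n) → Arrangement (suc n)
twoRuns {n} b m i with i ≤? m
... | yes _ = fromℕ< (≤-<-trans (m∸n≤m (toℕ m) (toℕ i)) (toℕ<n m)) , b
... | no _  = fromℕ< (s≤s (m∸n≤m n (toℕ i ∸ suc (toℕ m)))) , not b

private
  runs-ascend : ∀ k {m l n} → m ℕ.< l → l ℕ.≤ n → m ∸ k ℕ.< n ∸ (l ∸ suc m)
  runs-ascend k {m} {l} {n} m<l l≤n =
    ≤-<-trans (m∸n≤m m k) (m+n≤o⇒m≤o∸n (suc m) (subst (ℕ._≤ n) (sym (m+[n∸m]≡n m<l)) l≤n))

  second-run-descends : ∀ {k m l n} → m ℕ.< k → k ℕ.< l → l ℕ.≤ n →
    n ∸ (l ∸ suc m) ℕ.< n ∸ (k ∸ suc m)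
  second-run-descends {m = m} {l} m<k k<l l≤n =
    ∸-monoʳ-< (∸-monoˡ-< k<l m<k) (≤-trans (m∸n≤m l (suc m)) l≤n)

twoRuns-respects : ∀ {n} {b} {m : Fin (suc n)} → Respects rule2b1 (twoRuns b m)
twoRuns-respects {n} {b} {m} {k} {l} k<l with k ≤? m | l ≤? m
... | yes _   | yes l≤m = rule2b1-same b (fromℕ<-mono-< (∸-monoʳ-< k<l l≤m))
... | yes _   | no l≰m  =
  rule2b1-flip b (fromℕ<-mono-< (runs-ascend (toℕ k) (≰⇒> l≰m) (s≤s⁻¹ (toℕ<n l))))
... | no k≰m | yes l≤m = ⊥-elim (k≰m (<⇒≤ (<-≤-trans k<l l≤m)))
... | no k≰m | no _    =
  rule2b1-same (not b) (fromℕ<-mono-< (second-run-descends (≰⇒> k≰m) k<l (s≤s⁻¹ (toℕ<n l))))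

twoRuns-injective : ∀ {n} {b} {m : Fin (suc n)} → ValuesInjective (twoRuns b m)
twoRuns-injective = distinct⇒injective (λ k<l → rule2b1-distinct (twoRuns-respects k<l))

twoRuns-zero : ∀ {n} {b} {m : Fin (suc n)} → twoRuns b m zero ≡ (m , b)
twoRuns-zero {n} {b} {m} with zero {n} ≤? m
... | yes _  = cong (_, b) (fromℕ<-toℕ m (toℕ<n m))
... | no 0≰m = ⊥-elim (0≰m z≤n)

-- The run structure is read off from the position m of the value 0: by rule2b1 a letter
-- before m has the bar of m, and a letter after m has the other bar.
respects2b1⇒twoRuns : ∀ {n} {a : Arrangement (suc n)} → ValuesInjective a → Respects rule2b1 a →
  ∃₂ λ b m → a ≗ twoRuns b m
respects2b1⇒twoRuns {n} {a} a-inj r with injective⇒surjective a-inj zero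
... | m , am≡0 = barred (a m) , m ,
  ≗-from-bars-and-order a-inj twoRuns-injective bars (λ _ _ → order-from-pairs _ same-direction tt tt)
  where
  bars : ∀ i → barred (a i) ≡ barred (twoRuns (barred (a m)) m i)
  bars i with i ≤? m | i ≟ m
  ... | yes _   | yes refl = refl
  ... | yes i≤m | no i≢m   = rule2b1-into-zero am≡0 (r (≤∧≢⇒< i≤m i≢m))
  ... | no i≰m  | _        = rule2b1-from-zero am≡0 (r (≰⇒> i≰m))
  same-direction : ∀ {k l} → k < l → ⊤ → ⊤ →
    SameDirection (∣ a k ∣) (∣ a l ∣) (∣ twoRuns (barred (a m)) m k ∣) (∣ twoRuns (barred (a m)) m l ∣)
  same-direction {k} {l} k<l _ _ = rule2b1-same-direction (bars k) (bars l) (r k<l) (twoRuns-respects k<l)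

runsWord : ∀ {n} → Bool → Fin (suc n) → Word (suc n)
runsWord b m = tabulate (twoRuns b m)

runsWord-injective : ∀ {n} {b b′} {m m′ : Fin (suc n)} → runsWord b m ≡ runsWord b′ m′ → (m , b) ≡ (m′ , b′)
runsWord-injective {b = b} {b′} {m} {m′} eq = begin
  (m , b)             ≡⟨ sym twoRuns-zero ⟩
  twoRuns b m zero    ≡⟨ tabulate-injective {f = twoRuns b m} {twoRuns b′ m′} eq zero ⟩
  twoRuns b′ m′ zero  ≡⟨ twoRuns-zero ⟩
  (m′ , b′)           ∎
  where open ≡-Reasoning

runsWords⇔inB : ∀ {n} (α : Word (suc n)) →
  (Image (runsWord true) α ⊎ Image (runsWord false) α) ⇔ InB (suc n) (p2b1 ∷ T8) α
runsWords⇔inB {n} α = mk⇔ [ member , member ] classify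
  where
  member : ∀ {b} → Image (runsWord b) α → InB (suc n) (p2b1 ∷ T8) α
  member (_ , refl) =
    tabulate-inB {T = p2b1 ∷ T8} {rule2b1} avoids⇔respects2b1 twoRuns-injective twoRuns-respects
  classify : InB (suc n) (p2b1 ∷ T8) α → Image (runsWord true) α ⊎ Image (runsWord false) α
  classify (perm , avoids) with respects2b1⇒twoRuns perm (to (avoids⇔respects2b1 α perm) avoids)
  ... | true  , m , α≗ = inj₁ (m , tabulate-≗-lookup α≗)
  ... | false , m , α≗ = inj₂ (m , tabulate-≗-lookup α≗)

count2b1 : ∀ n → HasCount (suc n) (p2b1 ∷ T8) (2 * suc n)
count2b1 n = words , proj₁ enumeration , proj₂ enumeration , words-length
  where
  words : List (Word (suc n))
  words = List.tabulate (runsWord true) ++ List.tabulate (runsWord false)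
  true≢false : true ≢ false
  true≢false ()
  enumeration : Enumerates words (InB (suc n) (p2b1 ∷ T8))
  enumeration = enumerates-⇔ runsWords⇔inB
    (++-enumerates (tabulate-enumerates (cong proj₁ ∘ runsWord-injective))
                   (tabulate-enumerates (cong proj₁ ∘ runsWord-injective))
                   (λ (_ , eq) (_ , eq′) → true≢false (cong proj₂ (runsWord-injective (trans eq (sym eq′))))))
  words-length : length words ≡ 2 * suc n
  words-length = trans (length-tabulate-++ (runsWord true) (runsWord false))
                       (cong (suc n +_) (sym (+-identityʳ (suc n))))

-- T₈ ∪ {21}: at most one unbarred letter

opposite-mono-< : ∀ {N} {i j : Fin N} → i < j → opposite j < opposite i
opposite-mono-< {i = i} {j} i<j =
  subst₂ ℕ._<_ (sym (opposite-prop j)) (sym (opposite-prop i)) (∸-monoʳ-< (s≤s i<j) (toℕ<n j))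

punchIn-mono-< : ∀ {n} (u : Fin (suc n)) {j k : Fin n} → j < k → punchIn u j < punchIn u k
punchIn-mono-< u {j} {k} j<k =
  ≤∧≢⇒< (punchIn-mono-≤ u j k (<⇒≤ j<k)) (λ eq → <⇒≢ j<k (punchIn-injective u j k eq))

punchOut-mono-< : ∀ {n} {i j k : Fin (suc n)} (i≢j : i ≢ j) (i≢k : i ≢ k) → j < k →
  punchOut i≢j < punchOut i≢k
punchOut-mono-< i≢j i≢k j<k =
  ≤∧≢⇒< (punchOut-mono-≤ i≢j i≢k (<⇒≤ j<k)) (λ eq → <⇒≢ j<k (punchOut-injective i≢j i≢k eq))

descending : ∀ {N} → Arrangement N
descending i = opposite i , true

descending-respects : ∀ {N} → Respects rule21 (descending {N})
descending-respects = opposite-mono-<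

descending-injective : ∀ {N} → ValuesInjective (descending {N})
descending-injective = distinct⇒injective (λ k<l eq → <⇒≢ (opposite-mono-< k<l) (sym eq))

-- The unbarred letter u at position j; the other positions, read left to right, carry the
-- remaining values in decreasing order, all barred.
inserted : ∀ {n} → Fin (suc n) → Fin (suc n) → Arrangement (suc n)
inserted j u i with j ≟ i
... | yes _   = u , false
... | no j≢i = punchIn u (opposite (punchOut j≢i)) , true

inserted-at : ∀ {n} {j u : Fin (suc n)} → inserted j u j ≡ (u , false)
inserted-at {j = j} with j ≟ j
... | yes _   = refl
... | no j≢j = contradiction refl j≢j

inserted-unbarred : ∀ {n} {j u i : Fin (suc n)} → barred (inserted j u i) ≡ false → j ≡ i
inserted-unbarred {j = j} {i = i} unbarred with j ≟ i
... | yes j≡i = j≡i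
inserted-unbarred () | no _

inserted-descends : ∀ {n} {j u k l : Fin (suc n)} → k < l → j ≢ k → j ≢ l →
  ∣ inserted j u l ∣ < ∣ inserted j u k ∣
inserted-descends {j = j} {u} {k} {l} k<l j≢k j≢l with j ≟ k | j ≟ l
... | yes j≡k | _       = contradiction j≡k j≢k
... | no _    | yes j≡l = contradiction j≡l j≢l
... | no j≢k′ | no j≢l′ = punchIn-mono-< u (opposite-mono-< (punchOut-mono-< j≢k′ j≢l′ k<l))

inserted-injective : ∀ {n} {j u : Fin (suc n)} → ValuesInjective (inserted j u)
inserted-injective {j = j} {u} = distinct⇒injective distinct
  where
  distinct : ∀ {k l} → k < l → ∣ inserted j u k ∣ ≢ ∣ inserted j u l ∣
  distinct {k} {l} k<l with j ≟ k | j ≟ l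
  ... | yes refl | yes refl = ⊥-elim (<-irrefl refl k<l)
  ... | yes _    | no _     = punchInᵢ≢i u _ ∘ sym
  ... | no _     | yes _    = punchInᵢ≢i u _
  ... | no j≢k   | no j≢l   =
    λ eq → <⇒≢ (punchIn-mono-< u (opposite-mono-< (punchOut-mono-< j≢k j≢l k<l))) (sym eq)

-- The unbarred letter must lie below every later letter: automatic when u = 0, vacuous
-- when j is the last position.
inserted-respects : ∀ {n} {j u : Fin (suc n)} → u ≡ zero ⊎ j ≡ fromℕ n → Respects rule21 (inserted j u)
inserted-respects {n} {j} {u} minimum-or-last {k} {l} k<l with j ≟ k | j ≟ l
... | yes refl | yes refl = ⊥-elim (<-irrefl refl k<l)
... | yes refl | no j≢l   = below-rest minimum-or-last
  where
  below-rest : u ≡ zero ⊎ j ≡ fromℕ n → u < punchIn u (opposite (punchOut j≢l))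
  below-rest (inj₁ refl) = z<s
  below-rest (inj₂ refl) =
    ⊥-elim (<-irrefl refl (<-≤-trans (subst (ℕ._< toℕ l) (toℕ-fromℕ n) k<l) (s≤s⁻¹ (toℕ<n l))))
... | no _     | yes _    = tt
... | no j≢k   | no j≢l   = punchIn-mono-< u (opposite-mono-< (punchOut-mono-< j≢k j≢l k<l))

module _ {n} {a : Arrangement (suc n)} (a-inj : ValuesInjective a) (r : Respects rule21 a) where

  private
    rule21-at : ∀ {k l b c} → k < l → barred (a k) ≡ b → barred (a l) ≡ c → rule21 b c ∣ a k ∣ ∣ a l ∣
    rule21-at k<l refl refl = r k<l

    others-barred : ∀ {j k} → barred (a j) ≡ false → j ≢ k → barred (a k) ≡ true
    others-barred {j} {k} aj j≢k with barred (a k) in ak | <-cmp j k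
    ... | true  | _            = refl
    ... | false | tri< j<k _ _ = ⊥-elim (rule21-at j<k aj ak)
    ... | false | tri≈ _ j≡k _ = contradiction j≡k j≢k
    ... | false | tri> _ _ k<j = ⊥-elim (rule21-at k<j ak aj)

    all-barred⇒descending : (∀ i → barred (a i) ≡ true) → a ≗ descending
    all-barred⇒descending all-barred =
      ≗-from-bars-and-order a-inj descending-injective all-barred (λ _ _ →
        order-from-pairs (λ _ → ⊤)
          (λ k<l _ _ → descents (rule21-at k<l (all-barred _) (all-barred _)) (opposite-mono-< k<l)) tt tt)

    unbarred⇒inserted : ∀ {j} → barred (a j) ≡ false → a ≗ inserted j ∣ a j ∣
    unbarred⇒inserted {j} aj =
      ≗-from-bars-and-order a-inj (inserted-injective {j = j}) bars (λ ne ne′ →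
        order-from-pairs (j ≢_)
          (λ k<l j≢k j≢l → descents (rule21-at k<l (others-barred aj j≢k) (others-barred aj j≢l))
                                    (inserted-descends k<l j≢k j≢l))
          (off-j ne) (off-j ne′))
      where
      bars : ∀ i → barred (a i) ≡ barred (inserted j ∣ a j ∣ i)
      bars i with j ≟ i
      ... | yes refl = aj
      ... | no j≢i   = others-barred aj j≢i
      off-j : ∀ {i} → ∣ a i ∣ ≢ ∣ inserted j (∣ a j ∣) i ∣ → j ≢ i
      off-j ne refl = ne (sym (cong proj₁ (inserted-at {j = j})))

    -- Not being last, the unbarred letter lies below its barred right neighbour,
    -- which lies below every earlier (barred) letter.
    unbarred-minimum : ∀ {j} → barred (a (inject₁ j)) ≡ false →
      ∀ {k} → inject₁ j ≢ k → ∣ a (inject₁ j) ∣ < ∣ a k ∣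
    unbarred-minimum {j} aj {k} j≢k with <-cmp (inject₁ j) k
    ... | tri< j<k _ _ = rule21-at j<k aj (others-barred aj j≢k)
    ... | tri≈ _ j≡k _ = contradiction j≡k j≢k
    ... | tri> _ _ k<j =
      <-trans (rule21-at j<next aj next-barred)
              (rule21-at (<-trans k<j j<next) (others-barred aj j≢k) next-barred)
      where
      j<next : inject₁ j < suc j
      j<next = ≤̄⇒inject₁< (≤-refl {toℕ j})
      next-barred : barred (a (suc j)) ≡ true
      next-barred = others-barred aj (<⇒≢ j<next)

    unbarred-last : ∀ {j} → j ≡ fromℕ n → barred (a j) ≡ false → a ≗ inserted (fromℕ n) ∣ a j ∣
    unbarred-last refl = unbarred⇒inserted

    unbarred-not-last : ∀ j → barred (a (inject₁ j)) ≡ false → a ≗ inserted (inject₁ j) zero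
    unbarred-not-last j aj i = trans (unbarred⇒inserted aj i)
      (cong (λ u → inserted (inject₁ j) u i) (least-value≡zero {f = ∣_∣ ∘ a} a-inj (unbarred-minimum aj)))

  respects21⇒descending⊎inserted : a ≗ descending
             ⊎ (∃ λ u → a ≗ inserted (fromℕ n) u)
             ⊎ (∃ λ j → a ≗ inserted (inject₁ j) zero)
  respects21⇒descending⊎inserted with any? (λ i → barred (a i) Bool.≟ false)
  ... | no none = inj₁ (all-barred⇒descending all-barred)
    where
    all-barred : ∀ i → barred (a i) ≡ true
    all-barred i with barred (a i) in ai
    ... | true  = refl
    ... | false = contradiction (i , ai) none
  ... | yes (j , aj) with n ℕ.≟ toℕ j
  ...   | yes n≡j = inj₂ (inj₁ (∣ a j ∣ , unbarred-last j≡last aj))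
    where
    j≡last : j ≡ fromℕ n
    j≡last = toℕ-injective (trans (sym n≡j) (sym (toℕ-fromℕ n)))
  ...   | no n≢j = inj₂ (inj₂ (lower₁ j n≢j , unbarred-not-last (lower₁ j n≢j)
                     (subst (λ i → barred (a i) ≡ false) (sym (inject₁-lower₁ j n≢j)) aj)))

descendingWord : ∀ {N} → Word N
descendingWord = tabulate descending

insertedWord : ∀ {n} → Fin (suc n) → Fin (suc n) → Word (suc n)
insertedWord j u = tabulate (inserted j u)

insertedWord-position : ∀ {n} {j u j′ u′ : Fin (suc n)} → insertedWord j u ≡ insertedWord j′ u′ → j′ ≡ j
insertedWord-position {j = j} {u} {j′} {u′} eq = inserted-unbarred (begin
  barred (inserted j′ u′ j)  ≡⟨ cong proj₂ (tabulate-injective {f = inserted j u} {inserted j′ u′} eq j) ⟨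
  barred (inserted j u j)    ≡⟨ cong proj₂ (inserted-at {j = j} {u}) ⟩
  false                      ∎)
  where open ≡-Reasoning

insertedWord-value : ∀ {n} {j u u′ : Fin (suc n)} → insertedWord j u ≡ insertedWord j u′ → u ≡ u′
insertedWord-value {j = j} {u} {u′} eq = cong proj₁ (begin
  (u , false)      ≡⟨ inserted-at {j = j} {u} ⟨
  inserted j u j   ≡⟨ tabulate-injective {f = inserted j u} {inserted j u′} eq j ⟩
  inserted j u′ j  ≡⟨ inserted-at {j = j} {u′} ⟩
  (u′ , false)     ∎)
  where open ≡-Reasoning

insertedWord≢descendingWord : ∀ {n} {j u : Fin (suc n)} → insertedWord j u ≢ descendingWord
insertedWord≢descendingWord {j = j} {u} eq
  with () ← cong proj₂ (trans (sym (inserted-at {j = j} {u}))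
                              (tabulate-injective {f = inserted j u} {descending} eq j))

insertedWords⇔inB : ∀ {n} (α : Word (suc n)) →
  (Image (λ (_ : Fin 1) → descendingWord) α ⊎ Image (insertedWord (fromℕ n)) α
    ⊎ Image (λ j → insertedWord (inject₁ j) zero) α)
  ⇔ InB (suc n) (p21 ∷ T8) α
insertedWords⇔inB {n} α = mk⇔
  [ descending-member , [ (λ (_ , eq) → member (inj₂ refl) eq) , (λ (_ , eq) → member (inj₁ refl) eq) ] ]
  classify
  where
  descending-member : Image (λ (_ : Fin 1) → descendingWord) α → InB (suc n) (p21 ∷ T8) α
  descending-member (_ , refl) =
    tabulate-inB {T = p21 ∷ T8} {rule21} {descending}
      avoids⇔respects21 descending-injective descending-respects
  member : ∀ {j u} → u ≡ zero ⊎ j ≡ fromℕ n → insertedWord j u ≡ α → InB (suc n) (p21 ∷ T8) α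
  member {j} {u} zero-or-last refl = tabulate-inB {T = p21 ∷ T8} {rule21}
    avoids⇔respects21 (inserted-injective {j = j} {u}) (inserted-respects zero-or-last)
  classify : InB (suc n) (p21 ∷ T8) α →
    Image (λ (_ : Fin 1) → descendingWord) α ⊎ Image (insertedWord (fromℕ n)) α
      ⊎ Image (λ j → insertedWord (inject₁ j) zero) α
  classify (perm , avoids)
    with respects21⇒descending⊎inserted {a = lookup α} perm (to (avoids⇔respects21 α perm) avoids)
  ... | inj₁ α≗               = inj₁ (zero , tabulate-≗-lookup α≗)
  ... | inj₂ (inj₁ (u , α≗))  = inj₂ (inj₁ (u , tabulate-≗-lookup α≗))
  ... | inj₂ (inj₂ (j , α≗))  = inj₂ (inj₂ (j , tabulate-≗-lookup α≗))

count21 : ∀ n → HasCount (suc n) (p21 ∷ T8) (2 * suc n)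
count21 n = words , proj₁ enumeration , proj₂ enumeration , words-length
  where
  words : List (Word (suc n))
  words = descendingWord ∷ List.tabulate (insertedWord (fromℕ n))
                         ++ List.tabulate (λ j → insertedWord (inject₁ j) zero)
  enumeration : Enumerates words (InB (suc n) (p21 ∷ T8))
  enumeration = enumerates-⇔ insertedWords⇔inB
    (++-enumerates (tabulate-enumerates {m = 1} (λ { {zero} {zero} _ → refl }))
      (++-enumerates (tabulate-enumerates insertedWord-value)
                     (tabulate-enumerates (inject₁-injective ∘ sym ∘ insertedWord-position))
                     (λ (_ , eq) (_ , eq′) → fromℕ≢inject₁ (insertedWord-position (trans eq′ (sym eq)))))
      (λ (_ , eq) → [ (λ (_ , eq′) → insertedWord≢descendingWord (trans eq′ (sym eq)))
                    , (λ (_ , eq′) → insertedWord≢descendingWord (trans eq′ (sym eq))) ]))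
  words-length : length words ≡ 2 * suc n
  words-length = begin
    length words      ≡⟨ cong suc (length-tabulate-++ (insertedWord (fromℕ n)) (λ j → insertedWord (inject₁ j) zero)) ⟩
    suc (suc n + n)   ≡⟨ cong suc (sym (+-suc n n)) ⟩
    suc n + suc n     ≡⟨ cong (suc n +_) (sym (+-identityʳ (suc n))) ⟩
    2 * suc n         ∎
    where open ≡-Reasoning

mainTheorem7 : (τ : Pattern) → (τ ≡ p21 ⊎ τ ≡ p2b1) →
    (n : ℕ) → HasCount (suc n) (τ ∷ T8) (2 * suc n)
mainTheorem7 .p21  (inj₁ refl) = count21
mainTheorem7 .p2b1 (inj₂ refl) = count2b1
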